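{- Let $H$ be an arbitrary (finite, simple, nonempty) graph and let $n\in\mathbb{N}$. Then there exists a connected graph $G$ and a root $R_G$ of $G$ with $|V(R_G)|=n$ such that $H$ is isomorphic to $Res(G,R_G)$.
   Context: For a connected finite graph $G$ and a nonempty set $V_0\subseteq V(G)$, the distance partition $\{V_0,V_1,\dots,V_r\}$ of $V(G)$ is defined recursively by $V_{i+1}=\{v\in V(G)\setminus(V_0\cup\dots\cup V_i) : v \text{ is adjacent to some } u\in V_i\}$, with all $V_i$ nonempty; thus $V_i$ is the set of vertices at distance exactly $i$ from $V_0$. The root is the induced subgraph $R_G=\langle V_0\rangle$ and the distance-residual graph is the induced subgraph $Res(G,R_G)=\langle V_r\rangle$ on the last (farthest) class. -}

module Defs where

open import Data.Nat using (ℕ; zero; suc; _≤_; _<_)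
open import Data.Fin using (Fin)
open import Data.Fin.Subset using (Subset; _∈_; ∣_∣)
open import Data.Bool using (Bool; true; false)
open import Data.Product using (Σ; ∃; ∃-syntax; _×_; _,_)
open import Relation.Binary.PropositionalEquality using (_≡_)
open import Relation.Nullary using (¬_)
open import Function.Definitions using (Injective)

record Graph : Set where
  field
    size   : ℕ
    adj    : Fin size → Fin size → Bool
    sym    : ∀ u v → adj u v ≡ adj v u
    irrefl : ∀ v → adj v v ≡ false
open Graph public

Vtx : Graph → Set
Vtx G = Fin (size G)

data Walk (G : Graph) : Vtx G → Vtx G → ℕ → Set where
  here : ∀ {v} → Walk G v v zero
  step : ∀ {u w v k} → adj G u w ≡ true → Walk G w v k → Walk G u v (suc k)

Connected : Graph → Set
Connected G = ∀ (u v : Vtx G) → ∃[ k ] Walk G u v k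

Reach : (G : Graph) → Subset (size G) → Vtx G → ℕ → Set
Reach G V₀ v k = ∃[ u ] (u ∈ V₀ × Walk G u v k)

InClass : (G : Graph) → Subset (size G) → ℕ → Vtx G → Set
InClass G V₀ i v = Reach G V₀ v i × (∀ j → j < i → ¬ Reach G V₀ v j)

IsLastClass : (G : Graph) → Subset (size G) → ℕ → Set
IsLastClass G V₀ r =
  (∃[ v ] InClass G V₀ r v) × (∀ v i → InClass G V₀ i v → i ≤ r)

IsoToInduced : (H G : Graph) → (Vtx G → Set) → Set
IsoToInduced H G P =
  Σ (Vtx H → Vtx G) λ f →
    Injective _≡_ _≡_ f
    × (∀ x → P (f x))
    × (∀ v → P v → ∃[ x ] f x ≡ v)
    × (∀ x y → adj H x y ≡ adj G (f x) (f y))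

-- H ≅ Res(G, ⟨V₀⟩): isomorphic to the subgraph induced on the last class.
IsoToResidual : (H G : Graph) → Subset (size G) → Set
IsoToResidual H G V₀ =
  ∃[ r ] (IsLastClass G V₀ r × IsoToInduced H G (InClass G V₀ r))

{-# OPTIONS --safe #-}
module Submission where

-- Take the cone over the disjoint union of H with n isolated vertices, and
-- let the root be the n isolated vertices. The apex is adjacent to the
-- root, so it lies at distance 1; the vertices of H are adjacent only to
-- each other and to the apex, so they all lie at distance exactly 2, and
-- in a cone nothing is farther than 2 from a nonempty set.

open import Defs
open import Data.Nat using (ℕ; zero; suc; _+_; _≤_; _<_; z≤n; s≤s)
open import Data.Nat.Properties using (≮⇒≥; ≤-trans)
open import Data.Fin using (Fin; zero; suc; fromℕ<; splitAt; _↑ˡ_; _↑ʳ_)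
open import Data.Fin.Properties
  using (splitAt-↑ˡ; splitAt-↑ʳ; splitAt⁻¹-↑ˡ; splitAt⁻¹-↑ʳ; ↑ˡ-injective; suc-injective)
open import Data.Fin.Subset using (Subset; _∈_; _∉_; ∣_∣; ⊥; ⊤; outside)
open import Data.Fin.Subset.Properties using (∈⊤; drop-there; ∣⊤∣≡n)
open import Data.Vec using (_∷_; _++_; here; there)
open import Data.Bool using (Bool; true; false)
open import Data.Sum using (_⊎_; inj₁; inj₂)
open import Data.Product using (Σ; ∃-syntax; _×_; _,_)
open import Function using (_∘_)
open import Relation.Nullary using (¬_; contradiction)
open import Relation.Binary.PropositionalEquality
  using (_≡_; refl; trans; subst) renaming (sym to ≡-sym)

private
  variable
    m n i j : ℕ

data FinSumView (m n : ℕ) : Fin (m + n) → Set where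
  left  : (a : Fin m) → FinSumView m n (a ↑ˡ n)
  right : (b : Fin n) → FinSumView m n (m ↑ʳ b)

finSumView : ∀ m {n} (x : Fin (m + n)) → FinSumView m n x
finSumView m x with splitAt m x in eq
... | inj₁ a = subst (FinSumView m _) (splitAt⁻¹-↑ˡ eq) (left a)
... | inj₂ b = subst (FinSumView m _) (splitAt⁻¹-↑ʳ eq) (right b)

inRight : ∀ m n → Subset (m + n)
inRight m n = ⊥ {m} ++ ⊤ {n}

↑ʳ∈inRight : ∀ m (b : Fin n) → m ↑ʳ b ∈ inRight m n
↑ʳ∈inRight zero    b = ∈⊤
↑ʳ∈inRight (suc m) b = there (↑ʳ∈inRight m b)

↑ˡ∉inRight : ∀ (a : Fin m) → a ↑ˡ n ∉ inRight m n
↑ˡ∉inRight zero    ()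
↑ˡ∉inRight (suc a) a∈ = ↑ˡ∉inRight a (drop-there a∈)

∣inRight∣≡n : ∀ m n → ∣ inRight m n ∣ ≡ n
∣inRight∣≡n zero    n = ∣⊤∣≡n n
∣inRight∣≡n (suc m) n = ∣inRight∣≡n m n

NeighbourClosed : (K : Graph) → Subset (size K) → Set
NeighbourClosed K S = ∀ u v → u ∈ S → adj K u v ≡ true → v ∈ S

inClass-≤-reach : ∀ {G V₀ v} → InClass G V₀ i v → Reach G V₀ v j → i ≤ j
inClass-≤-reach {j = j} (_ , minimal) R = ≮⇒≥ (λ j<i → minimal j j<i R)

edgeless : ℕ → Graph
edgeless n = record
  { size = n ; adj = λ _ _ → false ; sym = λ _ _ → refl ; irrefl = λ _ → refl }

module _ (G K : Graph) where

  private
    adj⊎ : Fin (size G) ⊎ Fin (size K) → Fin (size G) ⊎ Fin (size K) → Bool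
    adj⊎ (inj₁ a) (inj₁ b) = adj G a b
    adj⊎ (inj₂ a) (inj₂ b) = adj K a b
    adj⊎ _        _        = false

    adj⊎-sym : ∀ p q → adj⊎ p q ≡ adj⊎ q p
    adj⊎-sym (inj₁ a) (inj₁ b) = sym G a b
    adj⊎-sym (inj₁ a) (inj₂ b) = refl
    adj⊎-sym (inj₂ a) (inj₁ b) = refl
    adj⊎-sym (inj₂ a) (inj₂ b) = sym K a b

    adj⊎-irrefl : ∀ p → adj⊎ p p ≡ false
    adj⊎-irrefl (inj₁ a) = irrefl G a
    adj⊎-irrefl (inj₂ b) = irrefl K b

  _⊕_ : Graph
  _⊕_ = record
    { size   = size G + size K
    ; adj    = λ x y → adj⊎ (splitAt (size G) x) (splitAt (size G) y)
    ; sym    = λ x y → adj⊎-sym (splitAt (size G) x) (splitAt (size G) y)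
    ; irrefl = λ x → adj⊎-irrefl (splitAt (size G) x)
    }

  ⊕-adj-↑ˡ : ∀ a b → adj _⊕_ (a ↑ˡ size K) (b ↑ˡ size K) ≡ adj G a b
  ⊕-adj-↑ˡ a b
    rewrite splitAt-↑ˡ (size G) a (size K) | splitAt-↑ˡ (size G) b (size K) = refl

  ⊕-adj-↑ʳ-↑ˡ : ∀ b a → adj _⊕_ (size G ↑ʳ b) (a ↑ˡ size K) ≡ false
  ⊕-adj-↑ʳ-↑ˡ b a
    rewrite splitAt-↑ʳ (size G) (size K) b | splitAt-↑ˡ (size G) a (size K) = refl

  ⊕-right-closed : NeighbourClosed _⊕_ (inRight (size G) (size K))
  ⊕-right-closed u v u∈ e with finSumView (size G) u | finSumView (size G) v
  ... | left a  | _       = contradiction u∈ (↑ˡ∉inRight a)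
  ... | right b | left a  with () ← trans (≡-sym (⊕-adj-↑ʳ-↑ˡ b a)) e
  ... | right _ | right b = ↑ʳ∈inRight (size G) b

  ⊕-left-isoToInduced : IsoToInduced G _⊕_ (_∉ inRight (size G) (size K))
  ⊕-left-isoToInduced =
    (_↑ˡ size K) , ↑ˡ-injective (size K) _ _ , ↑ˡ∉inRight , onto ,
    (λ a b → ≡-sym (⊕-adj-↑ˡ a b))
    where
    onto : ∀ x → x ∉ inRight (size G) (size K) → ∃[ a ] a ↑ˡ size K ≡ x
    onto x x∉ with finSumView (size G) x
    ... | left a  = a , refl
    ... | right b = contradiction (↑ʳ∈inRight (size G) b) x∉

cone : Graph → Graph
cone K = record { size = suc (size K) ; adj = adjC ; sym = symC ; irrefl = irreflC }
  where
  adjC : Fin (suc (size K)) → Fin (suc (size K)) → Bool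
  adjC zero    zero    = false
  adjC zero    (suc _) = true
  adjC (suc _) zero    = true
  adjC (suc x) (suc y) = adj K x y

  symC : ∀ u v → adjC u v ≡ adjC v u
  symC zero    zero    = refl
  symC zero    (suc _) = refl
  symC (suc _) zero    = refl
  symC (suc x) (suc y) = sym K x y

  irreflC : ∀ v → adjC v v ≡ false
  irreflC zero    = refl
  irreflC (suc x) = irrefl K x

module _ {K : Graph} where

  cone-walk≤2 : ∀ u w → ∃[ j ] (j ≤ 2 × Walk (cone K) u w j)
  cone-walk≤2 zero    zero    = 0 , z≤n , here
  cone-walk≤2 zero    (suc y) = 1 , s≤s z≤n , step refl here
  cone-walk≤2 (suc x) zero    = 1 , s≤s z≤n , step refl here
  cone-walk≤2 (suc x) (suc y) = 2 , s≤s (s≤s z≤n) , step {w = zero} refl (step refl here)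

  cone-connected : Connected (cone K)
  cone-connected u w with cone-walk≤2 u w
  ... | j , _ , walk = j , walk

  cone-class≤2 : ∀ {V₀ u w} → u ∈ V₀ → InClass (cone K) V₀ i w → i ≤ 2
  cone-class≤2 {u = u} {w} u∈V₀ w∈Vᵢ with cone-walk≤2 u w
  ... | j , j≤2 , walk = ≤-trans (inClass-≤-reach w∈Vᵢ (u , u∈V₀ , walk)) j≤2

  module _ {S : Subset (size K)} {u : Vtx K} (u∈S : u ∈ S) where

    cone-inClass₂ : NeighbourClosed K S → ∀ {v} → v ∉ S →
                    InClass (cone K) (outside ∷ S) 2 (suc v)
    cone-inClass₂ closed {v} v∉S =
      (suc u , there u∈S , step {w = zero} refl (step refl here)) , not-nearer
      where
      not-nearer : ∀ j → j < 2 → ¬ Reach (cone K) (outside ∷ S) (suc v) j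
      not-nearer 0 _ (_ , v∈ , here) = v∉S (drop-there v∈)
      not-nearer 1 _ (suc u′ , u′∈ , step e here) =
        v∉S (closed u′ v (drop-there u′∈) e)
      not-nearer (suc (suc _)) (s≤s (s≤s ()))

    cone-inClass₂⁻¹ : ∀ {w} → InClass (cone K) (outside ∷ S) 2 w →
                      ∃[ v ] (suc v ≡ w × v ∉ S)
    cone-inClass₂⁻¹ {zero} (_ , minimal) =
      contradiction (suc u , there u∈S , step refl here) (minimal 1 (s≤s (s≤s z≤n)))
    cone-inClass₂⁻¹ {suc v} (_ , minimal) =
      v , refl , λ v∈S → minimal 0 (s≤s z≤n) (suc v , there v∈S , here)

cone-isoToResidual : ∀ H K {S : Subset (size K)} {u} → u ∈ S → NeighbourClosed K S →
                     IsoToInduced H K (_∉ S) → Vtx H →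
                     IsoToResidual H (cone K) (outside ∷ S)
cone-isoToResidual H K {S} u∈S closed (f , f-inj , f∉S , f-onto , f-adj) x =
  2 , ((suc (f x) , inClass (f∉S x)) , λ _ _ → cone-class≤2 (there u∈S)) ,
  suc ∘ f , f-inj ∘ suc-injective , inClass ∘ f∉S , onto , f-adj
  where
  inClass : ∀ {v} → v ∉ S → InClass (cone K) (outside ∷ S) 2 (suc v)
  inClass = cone-inClass₂ u∈S closed

  onto : ∀ w → InClass (cone K) (outside ∷ S) 2 w → ∃[ x ] suc (f x) ≡ w
  onto w w∈V₂ with cone-inClass₂⁻¹ u∈S w∈V₂
  ... | v , refl , v∉S with f-onto v v∉S
  ... | x , refl = x , refl

theorem1 : (H : Graph) → 1 ≤ size H → (n : ℕ) → 1 ≤ n →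
    ∃[ G ] (Connected G ×
      Σ (Subset (size G)) λ V₀ → (∣ V₀ ∣ ≡ n × IsoToResidual H G V₀))
theorem1 H m≥1 n n≥1 =
  cone K , cone-connected , outside ∷ S , ∣inRight∣≡n (size H) n ,
  cone-isoToResidual H K (↑ʳ∈inRight (size H) (fromℕ< n≥1))
    (⊕-right-closed H (edgeless n)) (⊕-left-isoToInduced H (edgeless n)) (fromℕ< m≥1)
  where
  K : Graph
  K = H ⊕ edgeless n

  S : Subset (size K)
  S = inRight (size H) n
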